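{- Let $(G,F,\mathcal{C})$ be a framework, and let $e,f_1,f_2\in E(G)$ be distinct. If $e,f_1$ are twinned then $e,f_2$ are not twinned.
   Context: All graphs are finite and simple; paths and circuits have no repeated vertices. The ends of a path are its first and last vertices, its end-edges its first and last edges. For a set of edges $E'$, $G\setminus E'$ is obtained from $G$ by deleting those edges (keeping all vertices). For a path or circuit $C$, a sequence of vertices/edges is "in order" in $C$ if they are met in that order traversing $C$ (from one end if $C$ is a path; from some starting point if $C$ is a circuit). A framework is a triple $(G,F,\mathcal{C})$ where $G$ is cubic, $F$ is a subgraph of $G$, and $\mathcal{C}$ is a set of subgraphs of $G\setminus E(F)$, satisfying (F1)–(F7) below. Distinct edges $e,f$ are twinned if there exist distinct $C_1,C_2\in\mathcal{C}$ with $e,f\in E(C_1\cap C_2)$. (F1) Each member of $\mathcal{C}$ is an induced subgraph of $G\setminus E(F)$, has at least three edges, and is a path or a circuit. (F2) Every edge of $G\setminus E(F)$ belongs to some member of $\mathcal{C}$, and for every two edges $e,f$ of $G$ with a common end not in $V(F)$ there exists $C\in\mathcal{C}$ with $e,f\in E(C)$. (F3) If $C_1,C_2\in\mathcal{C}$ are distinct and $v\in V(C_1\cap C_2)$, then either $V(C_1\cap C_2)=\{v\}$, or $v$ is incident with an edge of $C_1\cap C_2$, or $v\in V(F)$. (F4) If $C_1\in\mathcal{C}$ is a path, every member of $\mathcal{C}$ containing an end-edge of $C_1$ is a path; and if $C_2\in\mathcal{C}\setminus\{C_1\}$ is also a path, then every component of $C_1\cap C_2$ contains an end of $C_1$, and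 every edge of $C_1\cap C_2$ is an end-edge of $C_1$. (F5) If $C\in\mathcal{C}$ is a circuit then $|V(C\cap F)|\le 1$ and every vertex of $C\cap F$ has degree 1 in $F$; if $C\in\mathcal{C}$ is a path then every vertex of $C\cap F$ is an end of $C$ and has degree 0 or 2 in $F$. (F6) If $e,f$ are twinned and $C\in\mathcal{C}$ with $e\in E(C)$, then $|V(C)|\le 6$ and either: $f\in E(C)$, $C$ is a circuit, $e,f$ have a common end in $V(F)$, and no path in $\mathcal{C}$ contains any vertex of $e$ or $f$; or $f\in E(C)$, $C$ is a path with end-edges $e,f$, and $C\cap F$ is null; or $f\notin E(C)$, $C$ is a path with $|E(C)|=3$, $e$ is an end-edge of $C$, and no end of $e$ is in $V(F)$. (F7) Let $C\in\mathcal{C}$ be a path of length five with twinned end-edges $e,f$. Then $|E(C')|\le 4$ for every path $C'\in\mathcal{C}\setminus\{C\}$ containing $e$. Moreover, let $C$ have vertices $v_0,v_1,\dots,v_5$ in order; then there exists $C'\in\mathcal{C}$ with end-edges $e$ and $f$ and with ends $v_0$ and $v_4$. -}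

module Defs where

open import Data.Nat using (ℕ; zero; suc; _≤_)
open import Data.Fin using (Fin; zero; suc; inject₁; fromℕ; _≟_)
open import Data.Fin.Subset using (Subset; _∈_; _∉_; _∩_; ∣_∣; ⊤)
open import Data.Bool using (Bool; _∨_)
open import Data.Vec using (tabulate)
open import Data.Product using (Σ; ∃; ∃-syntax; _×_; _,_; proj₁; proj₂)
open import Data.Sum using (_⊎_)
open import Data.List using (List)
import Data.List.Membership.Propositional as LM
open import Relation.Nullary using (¬_)
open import Relation.Nullary.Decidable using (⌊_⌋)
open import Relation.Binary.PropositionalEquality using (_≡_; _≢_)
open import Function.Definitions using (Injective)

infix 2 _⟺_
_⟺_ : Set → Set → Set
A ⟺ B = (A → B) × (B → A)

record Graph : Set where
  field
    n : ℕ
    m : ℕ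
    ends : Fin m → Fin n × Fin n
    loopless : ∀ e → proj₁ (ends e) ≢ proj₂ (ends e)
    simple : ∀ e f → (ends e ≡ ends f ⊎ ends e ≡ (proj₂ (ends f) , proj₁ (ends f))) → e ≡ f

module _ (G : Graph) where
  open Graph G

  SG : Set
  SG = Subset n × Subset m

  VS : SG → Subset n
  VS = proj₁

  ES : SG → Subset m
  ES = proj₂

  IsSubgraph : SG → Set
  IsSubgraph H = ∀ e → e ∈ ES H → (proj₁ (ends e) ∈ VS H) × (proj₂ (ends e) ∈ VS H)

  _⊓_ : SG → SG → SG
  H ⊓ K = (VS H ∩ VS K) , (ES H ∩ ES K)

  Incident : Fin m → Fin n → Set
  Incident e v = (proj₁ (ends e) ≡ v) ⊎ (proj₂ (ends e) ≡ v)

  Joins : Fin m → Fin n → Fin n → Set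
  Joins e u v = (ends e ≡ (u , v)) ⊎ (ends e ≡ (v , u))

  incB : Fin m → Fin n → Bool
  incB e v = ⌊ proj₁ (ends e) ≟ v ⌋ ∨ ⌊ proj₂ (ends e) ≟ v ⌋

  incSet : Fin n → Subset m
  incSet v = tabulate (λ e → incB e v)

  deg : SG → Fin n → ℕ
  deg H v = ∣ ES H ∩ incSet v ∣

  Cubic : Set
  Cubic = ∀ v → ∣ incSet v ∣ ≡ 3

  -- G \ E(F) and subgraphs / induced subgraphs of it
  SubgraphMinus : SG → SG → Set
  SubgraphMinus F H = IsSubgraph H × (∀ e → e ∈ ES H → e ∉ ES F)

  InducedMinus : SG → SG → Set
  InducedMinus F H = ∀ e → e ∉ ES F → proj₁ (ends e) ∈ VS H → proj₂ (ends e) ∈ VS H → e ∈ ES H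

  StepEdge : ∀ {k} → (Fin (suc k) → Fin n) → Fin k → Fin m → Set
  StepEdge p i e = Joins e (p (inject₁ i)) (p (suc i))

  -- H is the path with vertices p 0, ..., p k in order (k edges)
  PathRep : SG → (k : ℕ) → (Fin (suc k) → Fin n) → Set
  PathRep H k p =
    Injective _≡_ _≡_ p
    × (∀ v → v ∈ VS H ⟺ (∃[ i ] p i ≡ v))
    × (∀ i → ∃[ e ] StepEdge p i e)
    × (∀ e → e ∈ ES H ⟺ (∃[ i ] StepEdge p i e))

  -- H is the circuit with vertices p 0, ..., p (k+2) in cyclic order
  CircRep : SG → (k : ℕ) → (Fin (suc (suc (suc k))) → Fin n) → Set
  CircRep H k p =
    Injective _≡_ _≡_ p
    × (∀ v → v ∈ VS H ⟺ (∃[ i ] p i ≡ v))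
    × (∀ i → ∃[ e ] StepEdge p i e)
    × (∃[ e ] Joins e (p (fromℕ (suc (suc k)))) (p zero))
    × (∀ e → e ∈ ES H ⟺ ((∃[ i ] StepEdge p i e) ⊎ Joins e (p (fromℕ (suc (suc k)))) (p zero)))

  IsPath : SG → Set
  IsPath H = ∃[ k ] ∃[ p ] PathRep H k p

  IsCircuit : SG → Set
  IsCircuit H = ∃[ k ] ∃[ p ] CircRep H k p

  End : SG → Fin n → Set
  End H v = ∃[ k ] ∃[ p ] (PathRep H k p × ((v ≡ p zero) ⊎ (v ≡ p (fromℕ k))))

  EndEdge : SG → Fin m → Set
  EndEdge H e = ∃[ k ] ∃[ p ] (PathRep H (suc k) p × (StepEdge p zero e ⊎ StepEdge p (fromℕ k) e))

  EndEdgesAre : SG → Fin m → Fin m → Set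
  EndEdgesAre H e f = ∃[ k ] ∃[ p ] (PathRep H (suc k) p × StepEdge p zero e × StepEdge p (fromℕ k) f)

  EndsAre : SG → Fin n → Fin n → Set
  EndsAre H u v = ∃[ k ] ∃[ p ] (PathRep H k p × p zero ≡ u × p (fromℕ k) ≡ v)

  data Conn (H : SG) : Fin n → Fin n → Set where
    here : ∀ {v} → v ∈ VS H → Conn H v v
    step : ∀ {u v w e} → e ∈ ES H → Joins e u v → Conn H v w → Conn H u w

  module _ (F : SG) (𝒞 : List SG) where
    open LM using () renaming (_∈_ to _∈ℓ_)

    Twinned : Fin m → Fin m → Set
    Twinned e f = e ≢ f × ∃[ C₁ ] ∃[ C₂ ] (C₁ ∈ℓ 𝒞 × C₂ ∈ℓ 𝒞 × C₁ ≢ C₂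
                    × e ∈ ES C₁ × f ∈ ES C₁ × e ∈ ES C₂ × f ∈ ES C₂)

    F1 : Set
    F1 = ∀ C → C ∈ℓ 𝒞 → InducedMinus F C × 3 ≤ ∣ ES C ∣ × (IsPath C ⊎ IsCircuit C)

    F2 : Set
    F2 = (∀ e → e ∉ ES F → ∃[ C ] (C ∈ℓ 𝒞 × e ∈ ES C))
       × (∀ e f v → e ≢ f → Incident e v → Incident f v → v ∉ VS F
            → ∃[ C ] (C ∈ℓ 𝒞 × e ∈ ES C × f ∈ ES C))

    F3 : Set
    F3 = ∀ C₁ C₂ v → C₁ ∈ℓ 𝒞 → C₂ ∈ℓ 𝒞 → C₁ ≢ C₂ → v ∈ VS (C₁ ⊓ C₂)
         → (∀ u → u ∈ VS (C₁ ⊓ C₂) → u ≡ v)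
           ⊎ (∃[ e ] (e ∈ ES (C₁ ⊓ C₂) × Incident e v))
           ⊎ v ∈ VS F

    F4 : Set
    F4 = ∀ C₁ → C₁ ∈ℓ 𝒞 → IsPath C₁
         → (∀ C e → C ∈ℓ 𝒞 → EndEdge C₁ e → e ∈ ES C → IsPath C)
           × (∀ C₂ → C₂ ∈ℓ 𝒞 → C₂ ≢ C₁ → IsPath C₂
               → (∀ v → v ∈ VS (C₁ ⊓ C₂) → ∃[ u ] (End C₁ u × Conn (C₁ ⊓ C₂) v u))
                 × (∀ e → e ∈ ES (C₁ ⊓ C₂) → EndEdge C₁ e))

    F5 : Set
    F5 = ∀ C → C ∈ℓ 𝒞
         → (IsCircuit C → (∀ u v → u ∈ VS (C ⊓ F) → v ∈ VS (C ⊓ F) → u ≡ v)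
                          × (∀ v → v ∈ VS (C ⊓ F) → deg F v ≡ 1))
           × (IsPath C → ∀ v → v ∈ VS (C ⊓ F) → End C v × (deg F v ≡ 0 ⊎ deg F v ≡ 2))

    F6 : Set
    F6 = ∀ e f C → Twinned e f → C ∈ℓ 𝒞 → e ∈ ES C
         → ∣ VS C ∣ ≤ 6
           × ( (f ∈ ES C × IsCircuit C
                 × (∃[ v ] (Incident e v × Incident f v × v ∈ VS F))
                 × (∀ C' v → C' ∈ℓ 𝒞 → IsPath C' → (Incident e v ⊎ Incident f v) → v ∉ VS C'))
             ⊎ (f ∈ ES C × EndEdgesAre C e f × (∀ v → v ∉ VS (C ⊓ F)))
             ⊎ (f ∉ ES C × IsPath C × ∣ ES C ∣ ≡ 3 × EndEdge C e
                 × (∀ v → Incident e v → v ∉ VS F)))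

    F7 : Set
    F7 = ∀ C (p : Fin 6 → Fin n) e f → C ∈ℓ 𝒞 → PathRep C 5 p
         → StepEdge p zero e → StepEdge p (fromℕ 4) f → Twinned e f
         → (∀ C' → C' ∈ℓ 𝒞 → C' ≢ C → IsPath C' → e ∈ ES C' → ∣ ES C' ∣ ≤ 4)
           × (∃[ C' ] (C' ∈ℓ 𝒞 × EndEdgesAre C' e f × EndsAre C' (p zero) (p (inject₁ (fromℕ 4)))))

  record Framework (F : SG) (𝒞 : List SG) : Set where
    open LM using () renaming (_∈_ to _∈ℓ_)
    field
      cubic : Cubic
      F-subgraph : IsSubgraph F
      𝒞-subgraphs : ∀ C → C ∈ℓ 𝒞 → SubgraphMinus F C
      f1 : F1 F 𝒞
      f2 : F2 F 𝒞
      f3 : F3 F 𝒞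
      f4 : F4 F 𝒞
      f5 : F5 F 𝒞
      f6 : F6 F 𝒞
      f7 : F7 F 𝒞

-- Let e be twinned with f₁ via distinct members C₁, C₂ ∈ 𝒞 containing both,
-- and also with f₂ ∉ {e, f₁}.  Apply (F6) to e, f₁ and a member C ∋ e, f₁.
--   * If C is a circuit, e and f₁ meet at a vertex v ∈ V(F) and no path of 𝒞
--     touches e.  Then (F6) for e, f₂ must again give the circuit case, where
--     e and f₂ meet at a vertex of C ∩ F; by (F5) that vertex is v, so v
--     carries e, f₁, f₂ and its F-edge: four edges in a cubic graph.
--   * Otherwise C is a path with end-edges e, f₁ disjoint from F.  Now (F6)
--     for e, f₂ cannot give a circuit (a vertex of e would lie in F) nor a
--     second pair of end-edges e, f₂; so C has exactly three edges.
-- A three-edge path with end-edges e, f has all its vertices on e or f, so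
-- two such members of 𝒞 coincide, being induced subgraphs of G \ E(F).  Hence
-- C₁ = C₂, a contradiction.
module Submission where

open import Defs
open import Data.Nat using (ℕ; zero; suc; _≤_; z≤n; s≤s)
open import Data.Nat.Properties using (≤-trans; <-irrefl)
open import Data.Fin using (Fin; zero; suc; inject₁; fromℕ; _≟_)
open import Data.Fin.Properties using (fromℕ≢inject₁; suc-injective)
open import Data.Fin.Subset using (Subset; Nonempty; _∈_; _∉_; ∣_∣; _-_; _⊆_)
open import Data.Fin.Subset.Properties
  using (x∈p∩q⁺; x∈p∩q⁻; ⊆-antisym; x∈p∧x≢y⇒x∈p-y; x∈p⇒∣p-x∣<∣p∣;
         nonempty?; Empty-unique; ∣⊥∣≡0)
open import Data.Vec.Properties using (lookup⇒[]=; lookup∘tabulate)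
open import Data.Bool.Properties using (T-≡; T-∨)
open import Data.Product using (∃; ∃-syntax; _×_; _,_; proj₁; proj₂)
open import Data.Sum using (_⊎_; inj₁; inj₂; [_,_]′)
import Data.Sum as Sum
open import Data.Empty using (⊥; ⊥-elim)
open import Data.List using (List)
open import Data.List.Membership.Propositional using () renaming (_∈_ to _∈ℓ_)
open import Function.Bundles using (Equivalence)
open import Relation.Nullary using (¬_; yes; no)
open import Relation.Nullary.Decidable using (fromWitness)
open import Relation.Binary.PropositionalEquality
  using (_≡_; _≢_; refl; sym; trans; cong; cong₂; subst; ≢-sym)

module _ {k : ℕ} where

  ∣p-x∣≥n⇒∣p∣>n : ∀ {p : Subset k} {x n} → x ∈ p → n ≤ ∣ p - x ∣ → suc n ≤ ∣ p ∣
  ∣p-x∣≥n⇒∣p∣>n x∈p n≤ = ≤-trans (s≤s n≤) (x∈p⇒∣p-x∣<∣p∣ x∈p)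

  distinct₄⇒4≤∣p∣ : ∀ {p : Subset k} {a b c d} → a ∈ p → b ∈ p → c ∈ p → d ∈ p
    → a ≢ b → a ≢ c → a ≢ d → b ≢ c → b ≢ d → c ≢ d → 4 ≤ ∣ p ∣
  distinct₄⇒4≤∣p∣ a∈ b∈ c∈ d∈ a≢b a≢c a≢d b≢c b≢d c≢d =
    ∣p-x∣≥n⇒∣p∣>n a∈ (∣p-x∣≥n⇒∣p∣>n (keep b∈ a≢b)
      (∣p-x∣≥n⇒∣p∣>n (keep (keep c∈ a≢c) b≢c)
        (∣p-x∣≥n⇒∣p∣>n (keep (keep (keep d∈ a≢d) b≢d) c≢d) z≤n)))
    where
    keep : ∀ {q : Subset k} {x y} → y ∈ q → x ≢ y → y ∈ q - x
    keep y∈q x≢y = x∈p∧x≢y⇒x∈p-y y∈q (≢-sym x≢y)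

  ∣p∣≡suc⇒nonempty : ∀ {p : Subset k} {n} → ∣ p ∣ ≡ suc n → Nonempty p
  ∣p∣≡suc⇒nonempty {p} size with nonempty? p
  ... | yes ne = ne
  ... | no empty with () ← trans (sym size) (trans (cong ∣_∣ (Empty-unique empty)) (∣⊥∣≡0 k))

inject₁≢suc : ∀ {k} (i : Fin k) → inject₁ i ≢ suc i
inject₁≢suc zero ()
inject₁≢suc (suc i) eq = inject₁≢suc i (suc-injective eq)

inject₁²≢suc² : ∀ {k} (i : Fin k) → inject₁ (inject₁ i) ≢ suc (suc i)
inject₁²≢suc² zero ()
inject₁²≢suc² (suc i) eq = inject₁²≢suc² i (suc-injective eq)

last-or-inject₁ : ∀ {k} (j : Fin (suc k)) → j ≡ fromℕ k ⊎ ∃ λ i → j ≡ inject₁ i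
last-or-inject₁ {zero} zero = inj₁ refl
last-or-inject₁ {suc k} zero = inj₂ (zero , refl)
last-or-inject₁ {suc k} (suc j) = Sum.map (cong suc) (λ (i , eq) → suc i , cong suc eq) (last-or-inject₁ j)

module GraphFacts (G : Graph) where
  open Graph G

  joins-same-ends : ∀ {g a b c d} → Joins G g a b → Joins G g c d → (a ≡ c × b ≡ d) ⊎ (a ≡ d × b ≡ c)
  joins-same-ends (inj₁ p) (inj₁ q) with refl ← trans (sym p) q = inj₁ (refl , refl)
  joins-same-ends (inj₁ p) (inj₂ q) with refl ← trans (sym p) q = inj₂ (refl , refl)
  joins-same-ends (inj₂ p) (inj₁ q) with refl ← trans (sym p) q = inj₂ (refl , refl)
  joins-same-ends (inj₂ p) (inj₂ q) with refl ← trans (sym p) q = inj₁ (refl , refl)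

  swap : Fin n × Fin n → Fin n × Fin n
  swap (u , v) = v , u

  joins-unique : ∀ {g g' a b} → Joins G g a b → Joins G g' a b → g ≡ g'
  joins-unique {g} {g'} (inj₁ p) (inj₁ q) = simple g g' (inj₁ (trans p (sym q)))
  joins-unique {g} {g'} (inj₁ p) (inj₂ q) = simple g g' (inj₂ (trans p (cong swap (sym q))))
  joins-unique {g} {g'} (inj₂ p) (inj₁ q) = simple g g' (inj₂ (trans p (cong swap (sym q))))
  joins-unique {g} {g'} (inj₂ p) (inj₂ q) = simple g g' (inj₁ (trans p (sym q)))

  joins-distinct : ∀ {g g' a b c d} → Joins G g a b → Joins G g' c d → a ≢ c → a ≢ d → g ≢ g'
  joins-distinct g-ab g'-cd a≢c a≢d refl with joins-same-ends g-ab g'-cd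
  ... | inj₁ (a≡c , _) = a≢c a≡c
  ... | inj₂ (a≡d , _) = a≢d a≡d

  joins⇒incident₁ : ∀ {g a b} → Joins G g a b → Incident G g a
  joins⇒incident₁ (inj₁ p) = inj₁ (cong proj₁ p)
  joins⇒incident₁ (inj₂ p) = inj₂ (cong proj₂ p)

  joins⇒incident₂ : ∀ {g a b} → Joins G g a b → Incident G g b
  joins⇒incident₂ (inj₁ p) = inj₂ (cong proj₂ p)
  joins⇒incident₂ (inj₂ p) = inj₁ (cong proj₁ p)

  incident-joins : ∀ {g a b v} → Joins G g a b → Incident G g v → v ≡ a ⊎ v ≡ b
  incident-joins (inj₁ p) (inj₁ q) = inj₁ (trans (sym q) (cong proj₁ p))
  incident-joins (inj₁ p) (inj₂ q) = inj₂ (trans (sym q) (cong proj₂ p))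
  incident-joins (inj₂ p) (inj₁ q) = inj₂ (trans (sym q) (cong proj₁ p))
  incident-joins (inj₂ p) (inj₂ q) = inj₁ (trans (sym q) (cong proj₂ p))

  incident⇒∈VS : ∀ {H g v} → IsSubgraph G H → g ∈ ES G H → Incident G g v → v ∈ VS G H
  incident⇒∈VS {H} {g} H-sub g∈H (inj₁ eq) = subst (_∈ VS G H) eq (proj₁ (H-sub g g∈H))
  incident⇒∈VS {H} {g} H-sub g∈H (inj₂ eq) = subst (_∈ VS G H) eq (proj₂ (H-sub g g∈H))

  incident⇒∈incSet : ∀ {g v} → Incident G g v → g ∈ incSet G v
  incident⇒∈incSet {g} {v} inc =
    lookup⇒[]= g (incSet G v)
      (trans (lookup∘tabulate (λ e → incB G e v) g)
             (Equivalence.to T-≡ (Equivalence.from T-∨ (Sum.map (fromWitness {a? = proj₁ (ends g) ≟ v})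
                                                                (fromWitness {a? = proj₂ (ends g) ≟ v}) inc))))

  cubic⇒no-4-edges : Cubic G → ∀ {v a b c d} → a ∈ incSet G v → b ∈ incSet G v → c ∈ incSet G v
    → d ∈ incSet G v → a ≢ b → a ≢ c → a ≢ d → b ≢ c → b ≢ d → c ≢ d → ⊥
  cubic⇒no-4-edges cubic {v} a∈ b∈ c∈ d∈ a≢b a≢c a≢d b≢c b≢d c≢d =
    <-irrefl (sym (cubic v)) (distinct₄⇒4≤∣p∣ a∈ b∈ c∈ d∈ a≢b a≢c a≢d b≢c b≢d c≢d)

  path-vertex : ∀ {H k p} → PathRep G H k p → ∀ i → p i ∈ VS G H
  path-vertex {p = p} (_ , vertices , _) i = proj₂ (vertices (p i)) (i , refl)

  path-edge : ∀ {H k p i g} → PathRep G H k p → StepEdge G p i g → g ∈ ES G H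
  path-edge {i = i} (_ , _ , _ , edges) is-step = proj₂ (edges _) (i , is-step)

  OneEdgeAt : SG G → Fin n → Set
  OneEdgeAt H v = ∀ g g' → g ∈ ES G H → g' ∈ ES G H → Incident G g v → Incident G g' v → g ≡ g'

  -- An inner vertex p (j + 1) lies on the two distinct steps j and j + 1, so a
  -- vertex carrying only one edge of the path is one of its ends.
  one-edge⇒end : ∀ {H k p} → PathRep G H k p → ∀ i → OneEdgeAt H (p i)
    → p i ≡ p zero ⊎ p i ≡ p (fromℕ k)
  one-edge⇒end rep zero _ = inj₁ refl
  one-edge⇒end {k = suc k} {p} rep@(p-injective , _ , steps , _) (suc j) one with last-or-inject₁ j
  ... | inj₁ refl = inj₂ refl
  ... | inj₂ (i , refl) = ⊥-elim (distinct-steps (one _ _ (path-edge rep before) (path-edge rep after)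
                                                  (joins⇒incident₂ before) (joins⇒incident₁ after)))
    where
    before = proj₂ (steps (inject₁ i))
    after = proj₂ (steps (suc i))
    distinct-steps : proj₁ (steps (inject₁ i)) ≢ proj₁ (steps (suc i))
    distinct-steps = joins-distinct before after (λ eq → inject₁≢suc (inject₁ i) (p-injective eq))
                                                (λ eq → inject₁²≢suc² i (p-injective eq))

  module _ {H : SG G} {k : ℕ} {p : Fin (suc (suc k)) → Fin n} (rep : PathRep G H (suc k) p) where
    private
      p-injective = proj₁ rep
      edges = proj₂ (proj₂ (proj₂ rep))

    edge-at-first : ∀ {g} → g ∈ ES G H → Incident G g (p zero) → StepEdge G p zero g
    edge-at-first {g} g∈H inc with proj₁ (edges g) g∈H
    ... | zero , is-step = is-step
    ... | suc i , is-step with incident-joins is-step inc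
    ...   | inj₁ eq with () ← p-injective eq
    ...   | inj₂ eq with () ← p-injective eq

    edge-at-last : ∀ {g} → g ∈ ES G H → Incident G g (p (fromℕ (suc k))) → StepEdge G p (fromℕ k) g
    edge-at-last {g} g∈H inc with proj₁ (edges g) g∈H
    ... | i , is-step with incident-joins is-step inc
    ...   | inj₁ eq = ⊥-elim (fromℕ≢inject₁ (p-injective eq))
    ...   | inj₂ eq with refl ← suc-injective (p-injective eq) = is-step

    one-edge-at-last : OneEdgeAt H (p (fromℕ (suc k)))
    one-edge-at-last g g' g∈H g'∈H inc inc' = joins-unique (edge-at-last g∈H inc) (edge-at-last g'∈H inc')

  -- The last vertex of a path carries a single edge of it, so it is an end in
  -- every representation of the path.
  last-is-end : ∀ {H k k' p q} → PathRep G H (suc k) p → PathRep G H k' q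
    → p (fromℕ (suc k)) ≡ q zero ⊎ p (fromℕ (suc k)) ≡ q (fromℕ k')
  last-is-end {H} {k} P Q with proj₁ (proj₁ (proj₂ Q) _) (path-vertex P (fromℕ (suc k)))
  ... | i , qi≡v = Sum.map (trans (sym qi≡v)) (trans (sym qi≡v))
                     (one-edge⇒end Q i (subst (OneEdgeAt H) (sym qi≡v) (one-edge-at-last P)))

  -- A path has only one pair of end-edges starting with a given edge e: the
  -- far end of a second end-edge a is an end in the other representation,
  -- where its edge is either the first one, e, or the last one.
  end-edges-unique : ∀ {H e a b} → EndEdgesAre G H e a → EndEdgesAre G H e b → e ≢ a → a ≡ b
  end-edges-unique {a = a} (k , p , P , _ , a-last) (_ , _ , Q , e-first , b-last) e≢a =
    [ (λ at-first → ⊥-elim (e≢a (joins-unique e-first (edge-at-first Q a∈H (a-at at-first)))))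
    , (λ at-last → joins-unique (edge-at-last Q a∈H (a-at at-last)) b-last)
    ]′ (last-is-end P Q)
    where
    a∈H = path-edge P a-last
    a-at : ∀ {u} → p (fromℕ (suc k)) ≡ u → Incident G a u
    a-at eq = subst (Incident G a) eq (joins⇒incident₂ a-last)

  long-path⇒4≤∣E∣ : ∀ {H k p} → PathRep G H (suc (suc (suc (suc k)))) p → 4 ≤ ∣ ES G H ∣
  long-path⇒4≤∣E∣ {p = p} rep@(p-injective , _ , steps , _) =
    distinct₄⇒4≤∣p∣ (path-edge rep s₀) (path-edge rep s₁) (path-edge rep s₂) (path-edge rep s₃)
      (joins-distinct s₀ s₁ (apart λ ()) (apart λ ())) (joins-distinct s₀ s₂ (apart λ ()) (apart λ ()))
      (joins-distinct s₀ s₃ (apart λ ()) (apart λ ())) (joins-distinct s₁ s₂ (apart λ ()) (apart λ ()))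
      (joins-distinct s₁ s₃ (apart λ ()) (apart λ ())) (joins-distinct s₂ s₃ (apart λ ()) (apart λ ()))
    where
    apart : ∀ {i j} → i ≢ j → p i ≢ p j
    apart i≢j eq = i≢j (p-injective eq)
    s₀ = proj₂ (steps zero)
    s₁ = proj₂ (steps (suc zero))
    s₂ = proj₂ (steps (suc (suc zero)))
    s₃ = proj₂ (steps (suc (suc (suc zero))))

  ShortPath : SG G → Fin m → Fin m → Set
  ShortPath H e f = ∣ ES G H ∣ ≡ 3 × EndEdgesAre G H e f

  three-edge-path-vertices : ∀ {H e f} → ShortPath H e f → e ≢ f
    → ∀ v → v ∈ VS G H → Incident G e v ⊎ Incident G f v
  three-edge-path-vertices (_ , zero , _ , _ , e-first , f-last) e≢f _ _ =
    ⊥-elim (e≢f (joins-unique e-first f-last))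
  three-edge-path-vertices (three , suc (suc (suc _)) , _ , rep , _ , _) _ _ _ =
    ⊥-elim (<-irrefl (sym three) (long-path⇒4≤∣E∣ rep))
  three-edge-path-vertices (_ , suc zero , _ , rep , e-first , f-last) _ v v∈H
    with proj₁ (proj₁ (proj₂ rep) v) v∈H
  ... | zero , refl = inj₁ (joins⇒incident₁ e-first)
  ... | suc zero , refl = inj₁ (joins⇒incident₂ e-first)
  ... | suc (suc zero) , refl = inj₂ (joins⇒incident₂ f-last)
  three-edge-path-vertices (_ , suc (suc zero) , _ , rep , e-first , f-last) _ v v∈H
    with proj₁ (proj₁ (proj₂ rep) v) v∈H
  ... | zero , refl = inj₁ (joins⇒incident₁ e-first)
  ... | suc zero , refl = inj₁ (joins⇒incident₂ e-first)
  ... | suc (suc zero) , refl = inj₂ (joins⇒incident₁ f-last)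
  ... | suc (suc (suc zero)) , refl = inj₂ (joins⇒incident₂ f-last)

module FrameworkFacts {G : Graph} {F : SG G} {𝒞 : List (SG G)} (fw : Framework G F 𝒞) where
  open GraphFacts G
  open Graph G using (ends)
  open Framework fw

  member-subgraph : ∀ {C} → C ∈ℓ 𝒞 → IsSubgraph G C
  member-subgraph {C} C∈𝒞 = proj₁ (𝒞-subgraphs C C∈𝒞)

  member-avoids-F : ∀ {C g} → C ∈ℓ 𝒞 → g ∈ ES G C → g ∉ ES G F
  member-avoids-F {C} {g} C∈𝒞 = proj₂ (𝒞-subgraphs C C∈𝒞) g

  -- A three-edge member with end-edges e ≢ f lies inside every member
  -- containing e and f: its vertices are ends of e or f, and members are
  -- induced subgraphs of G \ E(F) (F1).
  short-path⊆member : ∀ {C C' e f} → C ∈ℓ 𝒞 → C' ∈ℓ 𝒞 → e ∈ ES G C → f ∈ ES G C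
    → ShortPath C' e f → e ≢ f → (VS G C' ⊆ VS G C) × (ES G C' ⊆ ES G C)
  short-path⊆member {C} {C'} C∈𝒞 C'∈𝒞 e∈C f∈C C'-short e≢f = V⊆ , E⊆
    where
    V⊆ : VS G C' ⊆ VS G C
    V⊆ {v} v∈C' = [ incident⇒∈VS (member-subgraph C∈𝒞) e∈C , incident⇒∈VS (member-subgraph C∈𝒞) f∈C ]′
                    (three-edge-path-vertices C'-short e≢f v v∈C')
    E⊆ : ES G C' ⊆ ES G C
    E⊆ {g} g∈C' = proj₁ (f1 C C∈𝒞) g (member-avoids-F C'∈𝒞 g∈C') (V⊆ (proj₁ ends∈C')) (V⊆ (proj₂ ends∈C'))
      where ends∈C' = member-subgraph C'∈𝒞 g g∈C'

  short-paths-equal : ∀ {C C' e f} → C ∈ℓ 𝒞 → C' ∈ℓ 𝒞 → ShortPath C e f → ShortPath C' e f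
    → e ≢ f → C ≡ C'
  short-paths-equal {e = e} {f = f} C∈𝒞 C'∈𝒞 C-short C'-short e≢f =
    cong₂ _,_ (⊆-antisym (proj₁ C⊆C') (proj₁ C'⊆C)) (⊆-antisym (proj₂ C⊆C') (proj₂ C'⊆C))
    where
    ⊆member : ∀ {C C'} → C ∈ℓ 𝒞 → C' ∈ℓ 𝒞 → ShortPath C e f → ShortPath C' e f
      → (VS G C' ⊆ VS G C) × (ES G C' ⊆ ES G C)
    ⊆member C∈𝒞 C'∈𝒞 (_ , _ , _ , rep , e-first , f-last) C'-short =
      short-path⊆member C∈𝒞 C'∈𝒞 (path-edge rep e-first) (path-edge rep f-last) C'-short e≢f
    C'⊆C = ⊆member C∈𝒞 C'∈𝒞 C-short C'-short
    C⊆C' = ⊆member C'∈𝒞 C∈𝒞 C'-short C-short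

  -- The circuit alternative of (F6) for e, f₁ in C leaves no further twin f₂
  -- of e: by (F6) f₂ meets e at a vertex of C ∩ F, by (F5) that is the common
  -- vertex v of e and f₁, and v would carry e, f₁, f₂ and its F-edge.
  circuit-twin-unique : ∀ {C e f₁ f₂} → C ∈ℓ 𝒞 → e ∈ ES G C → f₁ ∈ ES G C
    → e ≢ f₁ → e ≢ f₂ → f₁ ≢ f₂ → IsCircuit G C → (∃[ v ] (Incident G e v × Incident G f₁ v × v ∈ VS G F))
    → (∀ C' v → C' ∈ℓ 𝒞 → IsPath G C' → (Incident G e v ⊎ Incident G f₁ v) → v ∉ VS G C')
    → ¬ Twinned G F 𝒞 e f₂
  circuit-twin-unique {C} {e} {f₁} {f₂} C∈𝒞 e∈C f₁∈C e≢f₁ e≢f₂ f₁≢f₂ circuit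
                      (v , e-v , f₁-v , v∈F) no-path tw with proj₂ (f6 e f₂ C tw C∈𝒞 e∈C)
  ... | inj₁ (f₂∈C , _ , (w , _ , f₂-w , w∈F) , _) =
        cubic⇒no-4-edges cubic (incident⇒∈incSet e-v) (incident⇒∈incSet f₁-v) (incident⇒∈incSet f₂-v)
          (proj₂ g∈F∩v) e≢f₁ e≢f₂ (≢g e∈C) f₁≢f₂ (≢g f₁∈C) (≢g f₂∈C)
    where
    v∈C∩F = x∈p∩q⁺ (incident⇒∈VS (member-subgraph C∈𝒞) e∈C e-v , v∈F)
    one-vertex-in-F = proj₁ (proj₁ (f5 C C∈𝒞) circuit)
    w∈C∩F = x∈p∩q⁺ (incident⇒∈VS (member-subgraph C∈𝒞) f₂∈C f₂-w , w∈F)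
    f₂-v = subst (Incident G f₂) (one-vertex-in-F w v w∈C∩F v∈C∩F) f₂-w
    F-edge = ∣p∣≡suc⇒nonempty (proj₂ (proj₁ (f5 C C∈𝒞) circuit) v v∈C∩F)
    g∈F∩v = x∈p∩q⁻ (ES G F) (incSet G v) (proj₂ F-edge)
    ≢g : ∀ {x} → x ∈ ES G C → x ≢ proj₁ F-edge
    ≢g x∈C refl = member-avoids-F C∈𝒞 x∈C (proj₁ g∈F∩v)
  ... | inj₂ (inj₁ (_ , (k , p , rep , _) , _)) =
        no-path C (proj₁ (ends e)) C∈𝒞 (suc k , p , rep) (inj₁ (inj₁ refl))
          (proj₁ (member-subgraph C∈𝒞 e e∈C))
  ... | inj₂ (inj₂ (_ , C-path , _)) =
        no-path C (proj₁ (ends e)) C∈𝒞 C-path (inj₁ (inj₁ refl))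
          (proj₁ (member-subgraph C∈𝒞 e e∈C))

  twin-member-is-short-path : ∀ {C e f₁ f₂} → C ∈ℓ 𝒞 → e ∈ ES G C → f₁ ∈ ES G C → f₁ ≢ f₂
    → Twinned G F 𝒞 e f₁ → Twinned G F 𝒞 e f₂ → ShortPath C e f₁
  twin-member-is-short-path {C} {e} C∈𝒞 e∈C f₁∈C f₁≢f₂ tw₁@(e≢f₁ , _) tw₂@(e≢f₂ , _)
    with proj₂ (f6 e _ C tw₁ C∈𝒞 e∈C)
  ... | inj₁ (_ , circuit , meet , no-path) =
        ⊥-elim (circuit-twin-unique C∈𝒞 e∈C f₁∈C e≢f₁ e≢f₂ f₁≢f₂ circuit meet no-path tw₂)
  ... | inj₂ (inj₂ (f₁∉C , _)) = ⊥-elim (f₁∉C f₁∈C)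
  ... | inj₂ (inj₁ (_ , ends₁ , C∩F-empty)) with proj₂ (f6 e _ C tw₂ C∈𝒞 e∈C)
  ...   | inj₁ (_ , _ , (w , e-w , _ , w∈F) , _) =
          ⊥-elim (C∩F-empty w (x∈p∩q⁺ (incident⇒∈VS (member-subgraph C∈𝒞) e∈C e-w , w∈F)))
  ...   | inj₂ (inj₁ (_ , ends₂ , _)) = ⊥-elim (f₁≢f₂ (end-edges-unique ends₁ ends₂ e≢f₁))
  ...   | inj₂ (inj₂ (_ , _ , three , _)) = three , ends₁

theorem3p4 : (G : Graph) (F : SG G) (𝒞 : List (SG G)) → Framework G F 𝒞
    → (e f₁ f₂ : Fin (Graph.m G)) → e ≢ f₁ → e ≢ f₂ → f₁ ≢ f₂
    → Twinned G F 𝒞 e f₁ → ¬ Twinned G F 𝒞 e f₂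
theorem3p4 G F 𝒞 fw e f₁ f₂ e≢f₁ _ f₁≢f₂ tw₁ tw₂
  with tw₁
... | _ , C₁ , C₂ , C₁∈𝒞 , C₂∈𝒞 , C₁≢C₂ , e∈C₁ , f₁∈C₁ , e∈C₂ , f₁∈C₂ =
  C₁≢C₂ (short-paths-equal C₁∈𝒞 C₂∈𝒞 C₁-short C₂-short e≢f₁)
  where
  open FrameworkFacts fw
  C₁-short = twin-member-is-short-path C₁∈𝒞 e∈C₁ f₁∈C₁ f₁≢f₂ tw₁ tw₂
  C₂-short = twin-member-is-short-path C₂∈𝒞 e∈C₂ f₁∈C₂ f₁≢f₂ tw₁ tw₂
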